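{- Let $\sigma,k,w\ge2$ be integers and $\Sigma=\{0,\dots,\sigma-1\}$. Every nonempty prefix of an optimal arrangement of $\Sigma^k$ is an optimal arrangement (of its own domain).
   Context: A $k$-mer is a string of length $k$ over $\Sigma$. An arrangement of $\Sigma^k$ with domain $\varnothing\ne U\subseteq\Sigma^k$ is a sequence $\pi$ listing every element of $U$ exactly once; $\pi[i]$ has $\pi$-rank $i$, and a prefix $\pi[1..t]$ is an arrangement with domain $\{\pi[1],\dots,\pi[t]\}$. Let $n=k+w$. For a string $v$ of length $n$ (a window) and $i\in[1..|\pi|]$, $v$ is charged by $\pi$ due to $\pi[i]$ if $\pi[i]$ is the $k$-mer of minimum $\pi$-rank among the $k$-mers of the domain occurring in $v$, and $\pi[i]$ is either the length-$k$ prefix of $v$ or the length-$k$ suffix of $v$ having no other occurrence in $v$. Let $\mathsf{ch}(\pi,i)$ be the number of windows in $\Sigma^n$ charged by $\pi$ due to $\pi[i]$, and $\mathsf{ch}(\pi)=\sum_{i=1}^{|\pi|}\mathsf{ch}(\pi,i)$. An arrangement $\pi$ with domain $U$ is optimal if $\mathsf{ch}(\pi)\le\mathsf{ch}(\pi')$ for every arrangement $\pi'$ with domain $U$. -}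

module Defs where

open import Data.Nat using (ℕ; zero; suc; _+_; _∸_; _≤_; _≡ᵇ_)
open import Data.Fin using (Fin)
import Data.Fin.Properties as FinP
open import Data.Bool using (Bool; true; false; _∧_; _∨_; if_then_else_)
open import Data.Maybe using (Maybe; just; nothing)
open import Data.List using (List; []; _∷_; length; map; take; drop; upTo; allFin; concatMap; filter; lookup)
open import Data.Bool.ListAction using (any)
open import Data.Nat.ListAction using (sum)
open import Data.Bool.Properties using () renaming (_≟_ to _B≟_)
open import Data.List.Properties using (≡-dec)
open import Data.List.Relation.Unary.All using (All)
open import Data.List.Relation.Unary.Unique.Propositional using (Unique)
open import Data.List.Membership.Propositional using (_∈_)
open import Data.Product using (_×_)
open import Function.Bundles using (_⇔_)
open import Relation.Binary.PropositionalEquality using (_≡_; _≢_)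
open import Relation.Nullary.Decidable using (⌊_⌋)

Str : ℕ → Set
Str σ = List (Fin σ)

_==_ : ∀ {σ} → Str σ → Str σ → Bool
x == y = ⌊ ≡-dec FinP._≟_ x y ⌋

allWords : (σ n : ℕ) → List (Str σ)
allWords σ zero = [] ∷ []
allWords σ (suc n) = concatMap (λ a → map (a ∷_) (allWords σ n)) (allFin σ)

kmersOf : ∀ {σ} → (k : ℕ) → Str σ → List (Str σ)
kmersOf k v = map (λ i → take k (drop i v)) (upTo (suc (length v ∸ k)))

count : ∀ {σ} → Str σ → List (Str σ) → ℕ
count x [] = 0
count x (y ∷ ys) = if x == y then suc (count x ys) else count x ys

elem : ∀ {σ} → Str σ → List (Str σ) → Bool
elem x ys = any (x ==_) ys

firstIn : ∀ {σ} → List (Str σ) → List (Str σ) → Maybe (Str σ)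
firstIn [] occ = nothing
firstIn (x ∷ π) occ = if elem x occ then just x else firstIn π occ

maybeEq : ∀ {σ} → Maybe (Str σ) → Str σ → Bool
maybeEq (just y) x = y == x
maybeEq nothing x = false

charged : ∀ {σ} → (k : ℕ) → List (Str σ) → Str σ → Str σ → Bool
charged k π x v =
  maybeEq (firstIn π (kmersOf k v)) x
  ∧ ( (x == take k v)
    ∨ ((x == drop (length v ∸ k) v) ∧ (count x (kmersOf k v) ≡ᵇ 1)))

chAt : (σ k w : ℕ) → (π : List (Str σ)) → Fin (length π) → ℕ
chAt σ k w π i =
  length (filter (λ v → charged k π (lookup π i) v B≟ true) (allWords σ (k + w)))

ch : (σ k w : ℕ) → List (Str σ) → ℕ
ch σ k w π = sum (map (chAt σ k w π) (allFin (length π)))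

-- π is an arrangement of Σ^k (with domain its set of entries): a nonempty
-- duplicate-free sequence of k-mers.
IsArrangement : (σ k : ℕ) → List (Str σ) → Set
IsArrangement σ k π = All (λ x → length x ≡ k) π × Unique π × π ≢ []

SameDomain : ∀ {σ} → List (Str σ) → List (Str σ) → Set
SameDomain π π' = ∀ x → (x ∈ π) ⇔ (x ∈ π')

Optimal : (σ k w : ℕ) → List (Str σ) → Set
Optimal σ k w π =
  IsArrangement σ k π ×
  (∀ π' → IsArrangement σ k π' → SameDomain π π' → ch σ k w π ≤ ch σ k w π')

{-# OPTIONS --safe #-}
-- The windows charged due to a k-mer x depend only on x and on the set of
-- k-mers ranked before x.  Hence for π = A ++ B the charges due to A are
-- exactly those of A on its own, and the charges due to B depend on A only
-- through its domain.  Replacing A by another arrangement A' of the same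
-- domain therefore changes ch(π) by exactly ch(A') − ch(A), and optimality
-- of π forces ch(A) ≤ ch(A').
module Submission where

open import Defs
open import Data.Nat using (ℕ; suc; _+_; _≤_)
open import Data.Nat.Properties using (+-cancelʳ-≤; module ≤-Reasoning)
open import Data.Nat.ListAction using (sum)
open import Data.Nat.ListAction.Properties using (sum-++)
import Data.Fin.Properties as Fin
open import Data.Bool using (true; false; _∧_)
open import Data.Bool.Properties using () renaming (_≟_ to _B≟_)
open import Data.Maybe using (just; nothing; _<∣>_)
open import Data.List using (List; []; _∷_; _++_; length; map; take; drop; filter; lookup; allFin; tabulate)
open import Data.List.Properties using (≡-dec; ++-conicalˡ; filter-≐; map-++; map-cong-local; map-tabulate; tabulate-lookup; take++drop≡id)
open import Data.List.Membership.Propositional using (_∈_; _∉_)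
open import Data.List.Membership.Propositional.Properties using (∈-++⁺ʳ)
open import Data.List.Relation.Binary.Disjoint.Propositional using (Disjoint)
open import Data.List.Relation.Binary.Subset.Propositional using (_⊆_)
open import Data.List.Relation.Binary.Subset.Propositional.Properties using (⊆-refl; ++⁺)
open import Data.List.Relation.Unary.Any using (here; there)
import Data.List.Relation.Unary.All as All
import Data.List.Relation.Unary.All.Properties as All
open import Data.List.Relation.Unary.AllPairs using ([]; _∷_)
open import Data.List.Relation.Unary.Unique.Propositional using (Unique)
import Data.List.Relation.Unary.Unique.Propositional.Properties as Unique
open import Data.Product using (_×_; _,_; proj₁; proj₂)
open import Function using (_∘_)
open import Function.Bundles using (mk⇔; Equivalence)
open import Relation.Binary.PropositionalEquality
open import Relation.Nullary using (yes; no; contradiction)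

module _ {σ : ℕ} where

  private
    variable
      x y : Str σ
      A A' B occ : List (Str σ)

  ==-≢ : x ≢ y → x == y ≡ false
  ==-≢ {x} {y} x≢y with ≡-dec Fin._≟_ x y
  ... | yes x≡y = contradiction x≡y x≢y
  ... | no _    = refl

  firstIn-++ : ∀ A → firstIn (A ++ B) occ ≡ (firstIn A occ <∣> firstIn B occ)
  firstIn-++ []      = refl
  firstIn-++ {occ = occ} (a ∷ A) with elem a occ
  ... | true  = refl
  ... | false = firstIn-++ A

  firstIn-∈ : ∀ A → firstIn A occ ≡ just y → y ∈ A
  firstIn-∈ {occ = occ} (a ∷ A) e with elem a occ
  firstIn-∈ (a ∷ A) refl | true  = here refl
  ...                   | false = there (firstIn-∈ A e)

  firstIn≡nothing⇒¬elem : ∀ A → firstIn A occ ≡ nothing → y ∈ A → elem y occ ≡ false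
  firstIn≡nothing⇒¬elem {occ = occ} (a ∷ A) e y∈A with elem a occ in ea
  firstIn≡nothing⇒¬elem (a ∷ A) e (here refl) | false = ea
  firstIn≡nothing⇒¬elem (a ∷ A) e (there y∈A) | false = firstIn≡nothing⇒¬elem A e y∈A

  ¬elem⇒firstIn≡nothing : ∀ A → (∀ {y} → y ∈ A → elem y occ ≡ false) → firstIn A occ ≡ nothing
  ¬elem⇒firstIn≡nothing []      _ = refl
  ¬elem⇒firstIn≡nothing (a ∷ A) h rewrite h (here refl) = ¬elem⇒firstIn≡nothing A (h ∘ there)

  firstIn≡nothing-⊆ : ∀ A A' → A ⊆ A' → firstIn A' occ ≡ nothing → firstIn A occ ≡ nothing
  firstIn≡nothing-⊆ A A' A⊆A' e = ¬elem⇒firstIn≡nothing A (λ y∈A → firstIn≡nothing⇒¬elem A' e (A⊆A' y∈A))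

  firstIn-∉ : ∀ A → x ∉ A → firstIn A occ ≡ just y → y == x ≡ false
  firstIn-∉ A x∉A e = ==-≢ (λ { refl → x∉A (firstIn-∈ A e) })

  maybeEq-firstIn-++ˡ : ∀ A B → x ∉ B →
    maybeEq (firstIn (A ++ B) occ) x ≡ maybeEq (firstIn A occ) x
  maybeEq-firstIn-++ˡ {occ = occ} A B x∉B rewrite firstIn-++ {B = B} {occ} A
    with firstIn A occ
  ... | just _  = refl
  ... | nothing with firstIn B occ in eB
  ...   | nothing = refl
  ...   | just _  = firstIn-∉ B x∉B eB

  maybeEq-firstIn-++ʳ : ∀ A A' B → x ∉ A → x ∉ A' → A ⊆ A' → A' ⊆ A →
    maybeEq (firstIn (A ++ B) occ) x ≡ maybeEq (firstIn (A' ++ B) occ) x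
  maybeEq-firstIn-++ʳ {occ = occ} A A' B x∉A x∉A' A⊆A' A'⊆A
    rewrite firstIn-++ {B = B} {occ} A | firstIn-++ {B = B} {occ} A'
    with firstIn A occ in e | firstIn A' occ in e'
  ... | just _  | just _  = trans (firstIn-∉ A x∉A e) (sym (firstIn-∉ A' x∉A' e'))
  ... | nothing | nothing = refl
  ... | just _  | nothing with () ← trans (sym e) (firstIn≡nothing-⊆ A A' A⊆A' e')
  ... | nothing | just _  with () ← trans (sym e') (firstIn≡nothing-⊆ A' A A'⊆A e)

  charge : (k w : ℕ) → List (Str σ) → Str σ → ℕ
  charge k w π x = length (filter (λ v → charged k π x v B≟ true) (allWords σ (k + w)))

  ch≡sum-charge : ∀ k w π → ch σ k w π ≡ sum (map (charge k w π) π)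
  ch≡sum-charge k w π = cong sum (begin
    map (chAt σ k w π) (allFin (length π))   ≡⟨ map-tabulate (λ i → i) (chAt σ k w π) ⟩
    tabulate (charge k w π ∘ lookup π)       ≡⟨ map-tabulate (lookup π) (charge k w π) ⟨
    map (charge k w π) (tabulate (lookup π)) ≡⟨ cong (map (charge k w π)) (tabulate-lookup π) ⟩
    map (charge k w π) π                     ∎)
    where open ≡-Reasoning

  charge-cong : ∀ k w π π' → (∀ occ → maybeEq (firstIn π occ) x ≡ maybeEq (firstIn π' occ) x) →
    charge k w π x ≡ charge k w π' x
  charge-cong {x} k w π π' h = cong length
    (filter-≐ (λ v → charged k π x v B≟ true) (λ v → charged k π' x v B≟ true)
      (trans (sym (same _)) , trans (same _)) (allWords σ (k + w)))
    where
    same : ∀ v → charged k π x v ≡ charged k π' x v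
    same v = cong (_∧ _) (h (kmersOf k v))

  ch-++ : ∀ k w A B → Disjoint A B →
    ch σ k w (A ++ B) ≡ ch σ k w A + sum (map (charge k w (A ++ B)) B)
  ch-++ k w A B A#B = begin
    ch σ k w (A ++ B)                                    ≡⟨ ch≡sum-charge k w (A ++ B) ⟩
    sum (map (charge k w (A ++ B)) (A ++ B))             ≡⟨ cong sum (map-++ _ A B) ⟩
    sum (map (charge k w (A ++ B)) A ++ map (charge k w (A ++ B)) B)
                                                         ≡⟨ sum-++ (map _ A) _ ⟩
    sum (map (charge k w (A ++ B)) A) + chargesOfB       ≡⟨ cong (λ m → sum m + chargesOfB) charges-of-A ⟩
    sum (map (charge k w A) A) + chargesOfB              ≡⟨ cong (_+ chargesOfB) (ch≡sum-charge k w A) ⟨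
    ch σ k w A + chargesOfB                              ∎
    where
    open ≡-Reasoning
    chargesOfB : ℕ
    chargesOfB = sum (map (charge k w (A ++ B)) B)
    charges-of-A : map (charge k w (A ++ B)) A ≡ map (charge k w A) A
    charges-of-A = map-cong-local (All.tabulate λ x∈A →
      charge-cong k w (A ++ B) A λ _ → maybeEq-firstIn-++ˡ A B (λ x∈B → A#B (x∈A , x∈B)))

  charges-of-suffix-cong : ∀ k w A A' B → A ⊆ A' → A' ⊆ A → Disjoint A B → Disjoint A' B →
    map (charge k w (A ++ B)) B ≡ map (charge k w (A' ++ B)) B
  charges-of-suffix-cong k w A A' B A⊆A' A'⊆A A#B A'#B = map-cong-local (All.tabulate λ x∈B →
    charge-cong k w (A ++ B) (A' ++ B) λ _ →
      maybeEq-firstIn-++ʳ A A' B (λ x∈A → A#B (x∈A , x∈B)) (λ x∈A' → A'#B (x∈A' , x∈B)) A⊆A' A'⊆A)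

  Unique-++⁻ : ∀ A → Unique (A ++ B) → Unique A × Unique B × Disjoint A B
  Unique-++⁻ []      u            = [] , u , λ { (() , _) }
  Unique-++⁻ (a ∷ A) (a∉A++B ∷ u) with Unique-++⁻ A u
  ... | uA , uB , A#B = All.++⁻ˡ A a∉A++B ∷ uA , uB , λ
    { (here refl , a∈B) → All.lookup a∉A++B (∈-++⁺ʳ A a∈B) refl
    ; (there v∈A , v∈B) → A#B (v∈A , v∈B)
    }

  SameDomain⇒⊆ : SameDomain A A' → A ⊆ A'
  SameDomain⇒⊆ A≈A' = Equivalence.to (A≈A' _)

  SameDomain⇒⊇ : SameDomain A A' → A' ⊆ A
  SameDomain⇒⊇ A≈A' = Equivalence.from (A≈A' _)

  SameDomain-++ʳ : SameDomain A A' → SameDomain (A ++ B) (A' ++ B)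
  SameDomain-++ʳ A≈A' _ = mk⇔ (++⁺ (SameDomain⇒⊆ A≈A') ⊆-refl) (++⁺ (SameDomain⇒⊇ A≈A') ⊆-refl)

  IsArrangement-++⁻ˡ : ∀ {k} A → IsArrangement σ k (A ++ B) → A ≢ [] → IsArrangement σ k A
  IsArrangement-++⁻ˡ A (lengths , u , _) A≢[] = All.++⁻ˡ A lengths , proj₁ (Unique-++⁻ A u) , A≢[]

  IsArrangement-replace-prefix : ∀ {k} A A' → IsArrangement σ k (A ++ B) → IsArrangement σ k A' →
    A' ⊆ A → IsArrangement σ k (A' ++ B)
  IsArrangement-replace-prefix {B} A A' (lengths , u , _) (lengths' , u' , A'≢[]) A'⊆A
    with Unique-++⁻ A u
  ... | _ , uB , A#B =
    All.++⁺ lengths' (All.++⁻ʳ A lengths) ,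
    Unique.++⁺ u' uB (λ (v∈A' , v∈B) → A#B (A'⊆A v∈A' , v∈B)) ,
    A'≢[] ∘ ++-conicalˡ A' B

  Optimal-++⁻ˡ : ∀ {k w} A B → Optimal σ k w (A ++ B) → A ≢ [] → Optimal σ k w A
  Optimal-++⁻ˡ {k} {w} A B (arr , opt) A≢[] = IsArrangement-++⁻ˡ A arr A≢[] , optimal
    where
    A#B : Disjoint A B
    A#B = proj₂ (proj₂ (Unique-++⁻ A (proj₁ (proj₂ arr))))

    chargesOfB : ℕ
    chargesOfB = sum (map (charge k w (A ++ B)) B)

    optimal : ∀ A' → IsArrangement σ k A' → SameDomain A A' → ch σ k w A ≤ ch σ k w A'
    optimal A' arr' A≈A' = +-cancelʳ-≤ chargesOfB _ _ (begin
      ch σ k w A + chargesOfB                             ≡⟨ ch-++ k w A B A#B ⟨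
      ch σ k w (A ++ B)                                   ≤⟨ opt (A' ++ B) arr'++B (SameDomain-++ʳ A≈A') ⟩
      ch σ k w (A' ++ B)                                  ≡⟨ ch-++ k w A' B A'#B ⟩
      ch σ k w A' + sum (map (charge k w (A' ++ B)) B)    ≡⟨ cong (λ m → _ + sum m) charges-of-B ⟨
      ch σ k w A' + chargesOfB                            ∎)
      where
      open ≤-Reasoning
      A'#B : Disjoint A' B
      A'#B (v∈A' , v∈B) = A#B (SameDomain⇒⊇ A≈A' v∈A' , v∈B)
      arr'++B : IsArrangement σ k (A' ++ B)
      arr'++B = IsArrangement-replace-prefix A A' arr arr' (SameDomain⇒⊇ A≈A')
      charges-of-B : map (charge k w (A ++ B)) B ≡ map (charge k w (A' ++ B)) B
      charges-of-B = charges-of-suffix-cong k w A A' B (SameDomain⇒⊆ A≈A') (SameDomain⇒⊇ A≈A') A#B A'#B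

lemma2 : (σ k w : ℕ) → 2 ≤ σ → 2 ≤ k → 2 ≤ w →
    ∀ π → Optimal σ k w π →
    ∀ t → 1 ≤ t → t ≤ length π → Optimal σ k w (take t π)
lemma2 σ k w _ _ _ [] ((_ , _ , []≢[]) , _) _ _ _ = contradiction refl []≢[]
lemma2 σ k w _ _ _ π@(_ ∷ _) opt (suc t) _ _ =
  Optimal-++⁻ˡ (take (suc t) π) (drop (suc t) π)
    (subst (Optimal σ k w) (sym (take++drop≡id (suc t) π)) opt) (λ ())
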